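{- Let $H$ be any outcome of the construction below, and fix $\Delta>3$. Let $0\le i<k$ and let $x,y\in V$ satisfy $d_G(x,y)\ge (3\Delta)^i\,W(x,y)$. Then at least one of the following holds: (1) $d_H(x,y)\le \left(1+\frac{4i}{\Delta-3}\right)d_G(x,y)$; (2) $d_H(x,p_{i+1}(x))\le \frac{\Delta}{\Delta-3}\,d_G(x,y)$.
   Context: Let $G=(V,E,w)$ be an undirected graph on $n$ vertices with non-negative edge weights, $d_G$ its shortest-path distance, and $k\ge1$ an integer; $\nu=1/(2^k-1)$. For $x,y\in V$, $W(x,y)=\max\{w(e):e\in P_{xy}\}$ where $P_{xy}$ is a shortest $x$–$y$ path in $G$. Let $A_0=V$, $A_k=\emptyset$, and for $0\le i\le k-2$ let $A_{i+1}$ be obtained by including each element of $A_i$ independently with probability $q_i=n^{ -2^i\nu}\cdot 2^{ -2^i-1}$. For $0\le i\le k-1$ and $v\in V$, the pivot $p_i(v)$ is the vertex of $A_i$ closest to $v$ in $d_G$ (ties broken lexicographically); $p_k(v)$ does not exist, and a condition bounding the distance from $x$ to $p_k(x)$ is regarded as false. Let $d_G(u,A_{i+1})=\min_{a\in A_{i+1}}d_G(u,a)$ ($=\infty$ if $A_{i+1}=\emptyset$). For $u\in A_i\setminus A_{i+1}$, the bunch is $B(u)=\{v\in A_i: d_G(u,v)<d_G(u,A_{i+1})\}\cup\{p_j(u): i<j<k\}$. $H$ is the graph on $V$ with edges $\{u,v\}$ for all $u\in V$, $v\in B(u)$, of weight $d_G(u,v)$; $d_H$ is its shortest-path distance.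
   Formalization: The edge weights of G are non-negative rationals rather than non-negative reals, and the parameter Δ > 3 is taken in the rationals. -}

module Defs where

open import Data.Nat as ℕ using (ℕ; zero; suc)
open import Data.Integer using (+_)
open import Data.Rational as ℚ using (ℚ; 0ℚ; 1ℚ; _+_; _*_; _-_; _÷_; _⊔_; >-nonZero)
open import Data.Fin as Fin using (Fin)
open import Data.Bool using (Bool; true; false)
open import Data.List using (List; foldr; map; filter; allFin)
open import Data.Maybe using (Maybe; just; nothing)
open import Data.Product using (Σ; ∃; ∃-syntax; _×_; _,_)
open import Data.Sum using (_⊎_)
open import Data.Unit using (⊤)
open import Data.Empty using (⊥)
open import Relation.Nullary using (¬_)
open import Relation.Binary.PropositionalEquality using (_≡_; subst)
open import Data.Rational.Properties using (+-monoˡ-<; +-inverseʳ)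

data ℚ∞ : Set where
  fin : ℚ → ℚ∞
  ∞   : ℚ∞

_≤∞_ : ℚ∞ → ℚ∞ → Set
fin a ≤∞ fin b = a ℚ.≤ b
fin a ≤∞ ∞     = ⊤
∞     ≤∞ fin b = ⊥
∞     ≤∞ ∞     = ⊤

_<∞_ : ℚ∞ → ℚ∞ → Set
fin a <∞ fin b = a ℚ.< b
fin a <∞ ∞     = ⊤
∞     <∞ _     = ⊥

min∞ : ℚ∞ → ℚ∞ → ℚ∞
min∞ (fin a) (fin b) = fin (a ℚ.⊓ b)
min∞ (fin a) ∞       = fin a
min∞ ∞       b       = b

_^ℚ_ : ℚ → ℕ → ℚ
q ^ℚ zero  = 1ℚ
q ^ℚ suc m = q * (q ^ℚ m)

ℕtoℚ : ℕ → ℚ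
ℕtoℚ m = (+ m) ℚ./ 1

Δ-3>0 : (Δ : ℚ) → Δ ℚ.> ℕtoℚ 3 → (Δ - ℕtoℚ 3) ℚ.> 0ℚ
Δ-3>0 Δ h = subst (ℚ._< (Δ - ℕtoℚ 3)) (+-inverseʳ (ℕtoℚ 3)) (+-monoˡ-< (ℚ.- ℕtoℚ 3) h)

divPos : ℚ → (q : ℚ) → q ℚ.> 0ℚ → ℚ
divPos p q q>0 = (p ÷ q) {{>-nonZero q>0}}

-- Weighted graphs on vertex set Fin n, given by an edge relation:
-- E u v c  means "there is an edge {u,v} of (finite) weight c".

EdgeRel : ℕ → Set₁
EdgeRel n = Fin n → Fin n → ℚ → Set

data Walk {n : ℕ} (E : EdgeRel n) : Fin n → Fin n → Set where
  nil  : ∀ {x} → Walk E x x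
  cons : ∀ {x z y} (c : ℚ) → E x z c → Walk E z y → Walk E x y

len : ∀ {n} {E : EdgeRel n} {x y} → Walk E x y → ℚ
len nil           = 0ℚ
len (cons c _ p)  = c + len p

-- maximum edge weight on a walk (0 for the empty walk; weights are ≥ 0)
maxW : ∀ {n} {E : EdgeRel n} {x y} → Walk E x y → ℚ
maxW nil          = 0ℚ
maxW (cons c _ p) = c ⊔ maxW p

IsShortestDist : ∀ {n} → EdgeRel n → (Fin n → Fin n → ℚ∞) → Set
IsShortestDist {n} E d = ∀ (x y : Fin n) →
  (∀ (p : Walk E x y) → d x y ≤∞ fin (len p)) ×
  ((Σ (Walk E x y) λ p → d x y ≡ fin (len p)) ⊎ (d x y ≡ ∞ × ¬ Walk E x y))

Weights : ℕ → Set
Weights n = Fin n → Fin n → Maybe ℚ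

IsUndirectedNonneg : ∀ {n} → Weights n → Set
IsUndirectedNonneg {n} w =
  (∀ (u v : Fin n) → w u v ≡ w v u) ×
  (∀ (u v : Fin n) (c : ℚ) → w u v ≡ just c → 0ℚ ℚ.≤ c)

GEdge : ∀ {n} → Weights n → EdgeRel n
GEdge w u v c = w u v ≡ just c

-- The sampled hierarchy A_0 ⊇ A_1 ⊇ … ⊇ A_k (any outcome of the sampling):
-- A_0 = V, A_k = ∅, A_{j+1} ⊆ A_j for j < k.

IsHierarchy : ∀ {n} → ℕ → (ℕ → Fin n → Bool) → Set
IsHierarchy {n} k A =
  (∀ (v : Fin n) → A 0 v ≡ true) ×
  (∀ (v : Fin n) → A k v ≡ false) ×
  (∀ (j : ℕ) (v : Fin n) → j ℕ.< k → A (suc j) v ≡ true → A j v ≡ true)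

module Construction {n : ℕ} (k : ℕ) (A : ℕ → Fin n → Bool)
                    (dG : Fin n → Fin n → ℚ∞) where

  -- p is the pivot p_j(v): the vertex of A_j closest to v, ties broken
  -- lexicographically (by the order of Fin n).  No such p exists if A_j = ∅
  -- (in particular for j = k).
  IsPivot : ℕ → Fin n → Fin n → Set
  IsPivot j v p =
    A j p ≡ true ×
    (∀ (a : Fin n) → A j a ≡ true → dG v p ≤∞ dG v a) ×
    (∀ (a : Fin n) → A j a ≡ true → dG v a ≡ dG v p → p Fin.≤ a)

  distToSet : Fin n → ℕ → ℚ∞
  distToSet u j = foldr min∞ ∞ (map (dG u) (filter (λ a → A j a Data.Bool.≟ true) (allFin n)))
    where import Data.Bool

  InBunch : Fin n → Fin n → Set
  InBunch u v = ∃[ i ] (i ℕ.< k × A i u ≡ true × A (suc i) u ≡ false ×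
     ((A i v ≡ true × dG u v <∞ distToSet u (suc i)) ⊎
      (∃[ j ] (i ℕ.< j × j ℕ.< k × IsPivot j u v))))

  -- edges of H: {u,v} for v ∈ B(u), of weight d_G(u,v)
  -- (only finite weights give edges; an edge of weight ∞ is never useful)
  HEdge : EdgeRel n
  HEdge u v c = (InBunch u v ⊎ InBunch v u) × dG u v ≡ fin c

-- Induction on i, for every walk P (shortest or not) whose edges weigh at most W, where
-- (3Δ)^i W ≤ len P.  For i = 0, either y is in the bunch of x or some vertex of A₁ is at least as
-- close to x as y.  For i + 1, cut P greedily into pieces of length between T = (3Δ)^i W and
-- 3T ≤ len P / Δ and apply the hypothesis to each piece in both directions: either H stretches the
-- piece by at most 1 + 4i/(Δ-3), or both of its ends lie within len P/(Δ-3) in H of vertices of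
-- A_{i+1}.  In the second case take the first and last such ends u, v, with witnesses a, b.  Either
-- b is in the bunch of a, closing a path in H that pays len P/(Δ-3) four times, or some vertex of
-- A_{i+2} is at most d_G(a,b) from a, which gives (2).  A vertex of A_{i+1} within β of x in G
-- finally puts the pivot p_{i+1}(x) within β of x in H.

module Submission where

open import Defs
open import Data.Nat using (ℕ; suc; _<_; _≥_) renaming (_*_ to _*ℕ_)
open import Data.Rational using (ℚ; _+_; _*_; _-_; _≤_; _>_; 1ℚ)
open import Data.Fin using (Fin)
open import Data.Bool using (Bool)
open import Data.Product using (Σ; ∃-syntax; _×_)
open import Data.Sum using (_⊎_)
open import Relation.Binary.PropositionalEquality using (_≡_)

open import Level using (0ℓ)
open import Data.Nat as ℕ using (zero; z≤n; s≤s; _∸_)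
import Data.Nat.Properties as ℕP
import Data.Integer as ℤ
import Data.Integer.Properties as ℤP
import Data.Integer.Tactic.RingSolver as ℤ-Solver
open import Data.Rational as ℚ using (0ℚ)
import Data.Rational.Properties as ℚP
open import Data.Rational.Properties using (module ≤-Reasoning)
import Data.Rational.Unnormalised as ℚᵘ
import Data.Rational.Unnormalised.Properties as ℚᵘP
open import Data.Fin as Fin using ()
import Data.Fin.Properties as FinP
open import Data.Bool using (true; false; _≟_)
open import Data.Product using (∃; _,_; proj₁; proj₂)
open import Data.Sum using (inj₁; inj₂; map₂)
open import Data.Unit using (⊤; tt)
open import Data.Empty using (⊥; ⊥-elim)
open import Data.List using (List; []; _∷_; foldr; map; filter; allFin)
open import Data.List.Membership.Propositional using (_∈_)
open import Data.List.Membership.Propositional.Properties using (∈-map⁺; ∈-map⁻; ∈-filter⁺; ∈-filter⁻; ∈-allFin)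
open import Data.List.Relation.Unary.Any using (here; there)
open import Relation.Nullary using (¬_; Dec; yes; no)
open import Relation.Nullary.Decidable using (_×-dec_; _→-dec_; dec⇒maybe)
open import Relation.Binary.PropositionalEquality using (refl; sym; trans; cong; subst; module ≡-Reasoning)
open import Tactic.RingSolver using (solve-∀)
open import Tactic.RingSolver.Core.AlmostCommutativeRing using (AlmostCommutativeRing; fromCommutativeRing)

ℚ-ring : AlmostCommutativeRing 0ℓ 0ℓ
ℚ-ring = fromCommutativeRing ℚP.+-*-commutativeRing (λ q → dec⇒maybe (0ℚ ℚP.≟ q))

ℕtoℚ-+ : ∀ a b → ℕtoℚ (a ℕ.+ b) ≡ ℕtoℚ a + ℕtoℚ b
ℕtoℚ-+ a b = ℚP.toℚᵘ-injective (begin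
  ℚ.toℚᵘ (ℕtoℚ (a ℕ.+ b))               ≈⟨ ℚP.toℚᵘ-fromℚᵘ (integer (a ℕ.+ b)) ⟩
  integer (a ℕ.+ b)                     ≈⟨ ℚᵘ.*≡* (trans (cong (ℤ._* ℤ.1ℤ) (ℤP.pos-+ a b))
                                                        (unit-denominators (ℤ.+ a) (ℤ.+ b))) ⟩
  integer a ℚᵘ.+ integer b              ≈⟨ ℚᵘP.+-cong (ℚᵘP.≃-sym (ℚP.toℚᵘ-fromℚᵘ (integer a)))
                                                      (ℚᵘP.≃-sym (ℚP.toℚᵘ-fromℚᵘ (integer b))) ⟩
  ℚ.toℚᵘ (ℕtoℚ a) ℚᵘ.+ ℚ.toℚᵘ (ℕtoℚ b) ≈⟨ ℚᵘP.≃-sym (ℚP.toℚᵘ-homo-+ (ℕtoℚ a) (ℕtoℚ b)) ⟩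
  ℚ.toℚᵘ (ℕtoℚ a + ℕtoℚ b)              ∎)
  where
  open ℚᵘP.≃-Reasoning
  integer : ℕ → ℚᵘ.ℚᵘ
  integer m = ℚᵘ.mkℚᵘ (ℤ.+ m) 0
  unit-denominators : ∀ p q → (p ℤ.+ q) ℤ.* ℤ.1ℤ ≡ (p ℤ.* ℤ.1ℤ ℤ.+ q ℤ.* ℤ.1ℤ) ℤ.* ℤ.1ℤ
  unit-denominators = ℤ-Solver.solve-∀

ℕtoℚ-nonneg : ∀ m → 0ℚ ≤ ℕtoℚ m
ℕtoℚ-nonneg m = ℚP.nonNegative⁻¹ (ℕtoℚ m) {{ℚP.normalize-nonNeg m 1}}

p≤p+q : ∀ p {q} → 0ℚ ≤ q → p ≤ p + q
p≤p+q p {q} q≥0 = ℚP.≤-trans (ℚP.≤-reflexive (sym (ℚP.+-identityʳ p))) (ℚP.+-monoʳ-≤ p q≥0)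

*-nonneg : ∀ {p q} → 0ℚ ≤ p → 0ℚ ≤ q → 0ℚ ≤ p * q
*-nonneg {p} {q} p≥0 q≥0 =
  ℚP.nonNegative⁻¹ _ {{ℚP.nonNeg*nonNeg⇒nonNeg p {{ℚ.nonNegative p≥0}} q {{ℚ.nonNegative q≥0}}}}

*-monoˡ-≤ : ∀ r {p q} → 0ℚ ≤ r → p ≤ q → r * p ≤ r * q
*-monoˡ-≤ r r≥0 = ℚP.*-monoˡ-≤-nonNeg r {{ℚ.nonNegative r≥0}}

*-monoʳ-≤ : ∀ r {p q} → 0ℚ ≤ r → p ≤ q → p * r ≤ q * r
*-monoʳ-≤ r r≥0 = ℚP.*-monoʳ-≤-nonNeg r {{ℚ.nonNegative r≥0}}

p≤q*p : ∀ {p q} → 0ℚ ≤ p → 1ℚ ≤ q → p ≤ q * p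
p≤q*p {p} p≥0 q≥1 = ℚP.≤-trans (ℚP.≤-reflexive (sym (ℚP.*-identityˡ p))) (*-monoʳ-≤ p p≥0 q≥1)

1≤* : ∀ {p q} → 1ℚ ≤ p → 1ℚ ≤ q → 1ℚ ≤ p * q
1≤* {p} p≥1 q≥1 = ℚP.≤-trans p≥1 (ℚP.≤-trans (ℚP.≤-reflexive (sym (ℚP.*-identityʳ p)))
  (*-monoˡ-≤ p (ℚP.≤-trans (ℚP.nonNegative⁻¹ 1ℚ) p≥1) q≥1))

≤∞-refl : ∀ a → a ≤∞ a
≤∞-refl (fin a) = ℚP.≤-refl
≤∞-refl ∞       = tt

≤∞-trans : ∀ {a b c} → a ≤∞ b → b ≤∞ c → a ≤∞ c
≤∞-trans {fin a} {fin b} {fin c} p q = ℚP.≤-trans p q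
≤∞-trans {fin a} {fin b} {∞}     p q = tt
≤∞-trans {fin a} {∞}     {∞}     p q = tt
≤∞-trans {∞}     {∞}     {∞}     p q = tt

≤∞-≤-trans : ∀ {a p q} → a ≤∞ fin p → p ≤ q → a ≤∞ fin q
≤∞-≤-trans {a} = ≤∞-trans {a}

≤∞-∞ : ∀ a → a ≤∞ ∞
≤∞-∞ (fin a) = tt
≤∞-∞ ∞       = tt

_<∞?_ : ∀ a b → Dec (a <∞ b)
fin a <∞? fin b = a ℚP.<? b
fin a <∞? ∞     = yes tt
∞     <∞? b     = no λ ()

_≤∞?_ : ∀ a b → Dec (a ≤∞ b)
fin a ≤∞? fin b = a ℚP.≤? b
fin a ≤∞? ∞     = yes tt
∞     ≤∞? fin b = no λ ()
∞     ≤∞? ∞     = yes tt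

≤∞-reflexive : ∀ {a p} → a ≡ fin p → a ≤∞ fin p
≤∞-reflexive refl = ℚP.≤-refl

≮∞⇒≥∞ : ∀ {a b} → ¬ (a <∞ b) → b ≤∞ a
≮∞⇒≥∞ {fin a} {fin b} a≮b = ℚP.≮⇒≥ a≮b
≮∞⇒≥∞ {fin a} {∞}     a≮b = ⊥-elim (a≮b tt)
≮∞⇒≥∞ {∞}     {b}     _   = ≤∞-∞ b

≤∞-fin⇒fin : ∀ {a q} → a ≤∞ fin q → ∃[ p ] (a ≡ fin p × p ≤ q)
≤∞-fin⇒fin {fin p} p≤q = p , refl , p≤q

min∞≤ˡ : ∀ a b → min∞ a b ≤∞ a
min∞≤ˡ (fin a) (fin b) = ℚP.p⊓q≤p a b
min∞≤ˡ (fin a) ∞       = ℚP.≤-refl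
min∞≤ˡ ∞       b       = ≤∞-∞ b

min∞≤ʳ : ∀ a b → min∞ a b ≤∞ b
min∞≤ʳ (fin a) (fin b) = ℚP.p⊓q≤q a b
min∞≤ʳ (fin a) ∞       = tt
min∞≤ʳ ∞       b       = ≤∞-refl b

min∞-sel : ∀ a b → min∞ a b ≡ a ⊎ min∞ a b ≡ b
min∞-sel (fin a) (fin b) with ℚP.⊓-sel a b
... | inj₁ a⊓b≡a = inj₁ (cong fin a⊓b≡a)
... | inj₂ a⊓b≡b = inj₂ (cong fin a⊓b≡b)
min∞-sel (fin a) ∞       = inj₁ refl
min∞-sel ∞       b       = inj₂ refl

foldr-min∞-≤ : ∀ {x} xs → x ∈ xs → foldr min∞ ∞ xs ≤∞ x
foldr-min∞-≤ (x ∷ xs) (here refl) = min∞≤ˡ x (foldr min∞ ∞ xs)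
foldr-min∞-≤ (y ∷ xs) (there x∈xs) = ≤∞-trans (min∞≤ʳ y (foldr min∞ ∞ xs)) (foldr-min∞-≤ xs x∈xs)

foldr-min∞-attained : ∀ xs → foldr min∞ ∞ xs ≡ ∞ ⊎ foldr min∞ ∞ xs ∈ xs
foldr-min∞-attained []       = inj₁ refl
foldr-min∞-attained (y ∷ xs) with min∞-sel y (foldr min∞ ∞ xs) | foldr-min∞-attained xs
... | inj₁ min≡y | _           = inj₂ (here min≡y)
... | inj₂ min≡m | inj₁ m≡∞    = inj₁ (trans min≡m m≡∞)
... | inj₂ min≡m | inj₂ m∈xs   = inj₂ (there (subst (_∈ xs) (sym min≡m) m∈xs))

least : ∀ {m} (P : Fin m → Set) → (∀ a → Dec (P a)) → ∃ P → ∃[ p ] (P p × ∀ a → P a → p Fin.≤ a)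
least {suc m} P P? (a , Pa) with P? Fin.zero
... | yes P0 = Fin.zero , P0 , λ _ _ → z≤n
... | no ¬P0 with a | Pa
...   | Fin.zero  | P0  = ⊥-elim (¬P0 P0)
...   | Fin.suc a | Psa with least (λ b → P (Fin.suc b)) (λ b → P? (Fin.suc b)) (a , Psa)
...     | p , Psp , p-least = Fin.suc p , Psp , suc-least
  where
  suc-least : ∀ b → P b → Fin.suc p Fin.≤ b
  suc-least Fin.zero    P0  = ⊥-elim (¬P0 P0)
  suc-least (Fin.suc b) Psb = s≤s (p-least b Psb)

module _ {n} {E : EdgeRel n} where

  infixr 5 _++_

  _++_ : ∀ {x y z} → Walk E x y → Walk E y z → Walk E x z
  nil          ++ q = q
  cons c e p   ++ q = cons c e (p ++ q)

  len-++ : ∀ {x y z} (p : Walk E x y) (q : Walk E y z) → len (p ++ q) ≡ len p + len q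
  len-++ nil          q = sym (ℚP.+-identityˡ (len q))
  len-++ (cons c e p) q = trans (cong (c +_) (len-++ p q)) (sym (ℚP.+-assoc c (len p) (len q)))

  len-nonneg : (∀ {u v c} → E u v c → 0ℚ ≤ c) → ∀ {x y} (p : Walk E x y) → 0ℚ ≤ len p
  len-nonneg E≥0 nil          = ℚP.≤-refl
  len-nonneg E≥0 (cons c e p) = ℚP.+-mono-≤ (E≥0 e) (len-nonneg E≥0 p)

  EdgesAtMost : ℚ → ∀ {x y} → Walk E x y → Set
  EdgesAtMost W nil          = ⊤
  EdgesAtMost W (cons c _ p) = c ≤ W × EdgesAtMost W p

  EdgesAtMost-++ : ∀ {W x y z} (p : Walk E x y) {q : Walk E y z} →
                   EdgesAtMost W p → EdgesAtMost W q → EdgesAtMost W (p ++ q)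
  EdgesAtMost-++ nil          _          q≤W = q≤W
  EdgesAtMost-++ (cons c e p) (c≤W , p≤W) q≤W = c≤W , EdgesAtMost-++ p p≤W q≤W

  EdgesAtMost-maxW : ∀ {x y} (p : Walk E x y) → EdgesAtMost (maxW p) p
  EdgesAtMost-maxW p = bounded p ℚP.≤-refl
    where
    bounded : ∀ {W x y} (p : Walk E x y) → maxW p ≤ W → EdgesAtMost W p
    bounded nil          _   = tt
    bounded (cons c e p) m≤W = ℚP.≤-trans (ℚP.p≤p⊔q c (maxW p)) m≤W
                             , bounded p (ℚP.≤-trans (ℚP.p≤q⊔p c (maxW p)) m≤W)

  maxW-nonneg : ∀ {x y} (p : Walk E x y) → 0ℚ ≤ maxW p
  maxW-nonneg nil          = ℚP.≤-refl
  maxW-nonneg (cons c e p) = ℚP.≤-trans (maxW-nonneg p) (ℚP.p≤q⊔p c (maxW p))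

  module _ (E-sym : ∀ {u v c} → E u v c → E v u c) where

    reverse : ∀ {x y} → Walk E x y → Walk E y x
    reverse nil          = nil
    reverse (cons c e p) = reverse p ++ cons c (E-sym e) nil

    len-reverse : ∀ {x y} (p : Walk E x y) → len (reverse p) ≡ len p
    len-reverse nil          = refl
    len-reverse (cons c e p) = begin
      len (reverse p ++ cons c (E-sym e) nil) ≡⟨ len-++ (reverse p) (cons c (E-sym e) nil) ⟩
      len (reverse p) + (c + 0ℚ)              ≡⟨ cong (_+ (c + 0ℚ)) (len-reverse p) ⟩
      len p + (c + 0ℚ)                        ≡⟨ swap (len p) c ⟩
      c + len p                               ∎
      where
      open ≡-Reasoning
      swap : ∀ l c → l + (c + 0ℚ) ≡ c + l
      swap = solve-∀ ℚ-ring

    EdgesAtMost-reverse : ∀ {W x y} (p : Walk E x y) → EdgesAtMost W p → EdgesAtMost W (reverse p)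
    EdgesAtMost-reverse nil          _           = tt
    EdgesAtMost-reverse (cons c e p) (c≤W , p≤W) = EdgesAtMost-++ (reverse p) (EdgesAtMost-reverse p p≤W) (c≤W , tt)

module ShortestPaths {n} {E : EdgeRel n} {d : Fin n → Fin n → ℚ∞} (isD : IsShortestDist E d) where

  dist≤len : ∀ {x y} (p : Walk E x y) → d x y ≤∞ fin (len p)
  dist≤len {x} {y} = proj₁ (isD x y)

  dist-walk : ∀ {x y b} → d x y ≤∞ fin b → Σ (Walk E x y) λ p → len p ≤ b
  dist-walk {x} {y} d≤b with proj₂ (isD x y)
  ... | inj₁ (p , d≡p) = p , subst (_≤∞ fin _) d≡p d≤b
  ... | inj₂ (d≡∞ , _) = ⊥-elim (subst (_≤∞ fin _) d≡∞ d≤b)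

  dist-refl : ∀ {x} → d x x ≤∞ fin 0ℚ
  dist-refl = dist≤len nil

  dist-triangle : ∀ {x y z a b} → d x y ≤∞ fin a → d y z ≤∞ fin b → d x z ≤∞ fin (a + b)
  dist-triangle xy≤a yz≤b with dist-walk xy≤a | dist-walk yz≤b
  ... | p , p≤a | q , q≤b =
    ≤∞-≤-trans (dist≤len (p ++ q)) (subst (_≤ _) (sym (len-++ p q)) (ℚP.+-mono-≤ p≤a q≤b))

  module _ (E-nonneg : ∀ {u v c} → E u v c → 0ℚ ≤ c) where

    dist-nonneg : ∀ {x y b} → d x y ≤∞ fin b → 0ℚ ≤ b
    dist-nonneg xy≤b with dist-walk xy≤b
    ... | p , p≤b = ℚP.≤-trans (len-nonneg E-nonneg p) p≤b

  module _ (E-sym : ∀ {u v c} → E u v c → E v u c) where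

    dist-sym : ∀ {x y b} → d x y ≤∞ fin b → d y x ≤∞ fin b
    dist-sym xy≤b with dist-walk xy≤b
    ... | p , p≤b = ≤∞-≤-trans (dist≤len (reverse E-sym p)) (subst (_≤ _) (sym (len-reverse E-sym p)) p≤b)

    dist-sym-fin : ∀ {x y b} → d x y ≡ fin b → d y x ≡ fin b
    dist-sym-fin {x} {y} {b} xy≡b with ≤∞-fin⇒fin (dist-sym (≤∞-reflexive xy≡b))
    ... | a , yx≡a , a≤b = trans yx≡a (cong fin (ℚP.≤-antisym a≤b b≤a))
      where
      b≤a : b ≤ a
      b≤a = subst (_≤∞ fin a) xy≡b (dist-sym (≤∞-reflexive yx≡a))

module Constants (Δ : ℚ) (Δ>3 : Δ > ℕtoℚ 3) where

  δ : ℚ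
  δ = Δ - ℕtoℚ 3

  δ>0 : δ > 0ℚ
  δ>0 = Δ-3>0 Δ Δ>3

  instance
    δ≢0 : ℚ.NonZero δ
    δ≢0 = ℚ.>-nonZero δ>0

  1/δ : ℚ
  1/δ = ℚ.1/ δ

  stretch : ℕ → ℚ
  stretch i = 1ℚ + divPos (ℕtoℚ (4 *ℕ i)) δ δ>0

  pivotStretch : ℚ
  pivotStretch = divPos Δ δ δ>0

  scale : ℕ → ℚ
  scale i = (ℕtoℚ 3 * Δ) ^ℚ i

  slack : ℚ → ℚ
  slack D = D * 1/δ

  1/δ≥0 : 0ℚ ≤ 1/δ
  1/δ≥0 = ℚP.<⇒≤ (ℚP.positive⁻¹ 1/δ {{ℚP.1/pos⇒pos δ {{ℚ.positive δ>0}}}})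

  1≤3 : 1ℚ ≤ ℕtoℚ 3
  1≤3 = ℚ.*≤* (ℤ.+≤+ (s≤s z≤n))

  Δ≥0 : 0ℚ ≤ Δ
  Δ≥0 = ℚP.≤-trans (ℕtoℚ-nonneg 3) (ℚP.<⇒≤ Δ>3)

  slack-nonneg : ∀ {D} → 0ℚ ≤ D → 0ℚ ≤ slack D
  slack-nonneg D≥0 = *-nonneg D≥0 1/δ≥0

  stretch≥1 : ∀ i → 1ℚ ≤ stretch i
  stretch≥1 i = p≤p+q 1ℚ (*-nonneg (ℕtoℚ-nonneg (4 *ℕ i)) 1/δ≥0)

  stretch-suc : ∀ i D → stretch (suc i) * D ≡ stretch i * D + ℕtoℚ 4 * slack D
  stretch-suc i D = begin
    (1ℚ + ℕtoℚ (4 *ℕ suc i) * 1/δ) * D                ≡⟨ cong (λ m → (1ℚ + ℕtoℚ m * 1/δ) * D) (ℕP.*-suc 4 i) ⟩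
    (1ℚ + ℕtoℚ (4 ℕ.+ 4 *ℕ i) * 1/δ) * D              ≡⟨ cong (λ q → (1ℚ + q * 1/δ) * D) (ℕtoℚ-+ 4 (4 *ℕ i)) ⟩
    (1ℚ + (ℕtoℚ 4 + ℕtoℚ (4 *ℕ i)) * 1/δ) * D         ≡⟨ distribute (ℕtoℚ 4) (ℕtoℚ (4 *ℕ i)) 1/δ D ⟩
    (1ℚ + ℕtoℚ (4 *ℕ i) * 1/δ) * D + ℕtoℚ 4 * slack D ∎
    where
    open ≡-Reasoning
    distribute : ∀ a b r D → (1ℚ + (a + b) * r) * D ≡ (1ℚ + b * r) * D + a * (D * r)
    distribute = solve-∀ ℚ-ring

  stretch-mono : ∀ i {D} → 0ℚ ≤ D → stretch i * D ≤ stretch (suc i) * D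
  stretch-mono i {D} D≥0 = ℚP.≤-trans (p≤p+q (stretch i * D) (*-nonneg (ℕtoℚ-nonneg 4) (slack-nonneg D≥0)))
                                      (ℚP.≤-reflexive (sym (stretch-suc i D)))

  pivotStretch-* : ∀ D → pivotStretch * D ≡ D + ℕtoℚ 3 * slack D
  pivotStretch-* D = begin
    Δ * 1/δ * D                      ≡⟨ split Δ (ℕtoℚ 3) 1/δ D ⟩
    δ * 1/δ * D + ℕtoℚ 3 * slack D   ≡⟨ cong (λ t → t * D + ℕtoℚ 3 * slack D) (ℚP.*-inverseʳ δ) ⟩
    1ℚ * D + ℕtoℚ 3 * slack D        ≡⟨ cong (_+ ℕtoℚ 3 * slack D) (ℚP.*-identityˡ D) ⟩
    D + ℕtoℚ 3 * slack D             ∎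
    where
    open ≡-Reasoning
    split : ∀ Δ t r D → Δ * r * D ≡ (Δ - t) * r * D + t * (D * r)
    split = solve-∀ ℚ-ring

  ≤pivotStretch* : ∀ {D} → 0ℚ ≤ D → D ≤ pivotStretch * D
  ≤pivotStretch* {D} D≥0 = ℚP.≤-trans (p≤p+q D (*-nonneg (ℕtoℚ-nonneg 3) (slack-nonneg D≥0)))
                                       (ℚP.≤-reflexive (sym (pivotStretch-* D)))

  pivotStretch*≤slack : ∀ {T D L} → ℕtoℚ 3 * Δ * T ≤ D → L ≤ T + T + T → pivotStretch * L ≤ slack D
  pivotStretch*≤slack {T} {D} {L} 3ΔT≤D L≤3T = begin
    pivotStretch * L           ≤⟨ *-monoˡ-≤ pivotStretch (*-nonneg Δ≥0 1/δ≥0) L≤3T ⟩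
    Δ * 1/δ * (T + T + T)      ≡⟨ regroup Δ 1/δ T ⟩
    ℕtoℚ 3 * Δ * T * 1/δ       ≤⟨ *-monoʳ-≤ 1/δ 1/δ≥0 3ΔT≤D ⟩
    slack D                    ∎
    where
    open ≤-Reasoning
    regroup : ∀ Δ r T → Δ * r * (T + T + T) ≡ ℕtoℚ 3 * Δ * T * r
    regroup = solve-∀ ℚ-ring

  1≤3Δ : 1ℚ ≤ ℕtoℚ 3 * Δ
  1≤3Δ = 1≤* 1≤3 (ℚP.≤-trans 1≤3 (ℚP.<⇒≤ Δ>3))

  1≤scale : ∀ i → 1ℚ ≤ scale i
  1≤scale zero    = ℚP.≤-refl
  1≤scale (suc i) = 1≤* 1≤3Δ (1≤scale i)

  bunch-route≤ : ∀ {i l₁ l₂ l₃ D} → 0ℚ ≤ l₂ → l₁ + (l₂ + l₃) ≤ D →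
                 stretch i * l₁ + (slack D + ((slack D + (l₂ + slack D)) + (slack D + stretch i * l₃)))
                   ≤ stretch (suc i) * D
  bunch-route≤ {i} {l₁} {l₂} {l₃} {D} l₂≥0 l≤D = begin
    s * l₁ + (e + ((e + (l₂ + e)) + (e + s * l₃))) ≡⟨ regroup s e l₁ l₂ l₃ ⟩
    s * l₁ + (l₂ + s * l₃) + ℕtoℚ 4 * e           ≤⟨ ℚP.+-monoˡ-≤ (ℕtoℚ 4 * e) (ℚP.+-monoʳ-≤ (s * l₁)
                                                        (ℚP.+-monoˡ-≤ (s * l₃) (p≤q*p l₂≥0 (stretch≥1 i)))) ⟩
    s * l₁ + (s * l₂ + s * l₃) + ℕtoℚ 4 * e       ≡⟨ cong (_+ ℕtoℚ 4 * e) (factor s l₁ l₂ l₃) ⟩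
    s * (l₁ + (l₂ + l₃)) + ℕtoℚ 4 * e             ≤⟨ ℚP.+-monoˡ-≤ (ℕtoℚ 4 * e) (*-monoˡ-≤ s s≥0 l≤D) ⟩
    s * D + ℕtoℚ 4 * e                            ≡⟨ stretch-suc i D ⟨
    stretch (suc i) * D                           ∎
    where
    open ≤-Reasoning
    s e : ℚ
    s = stretch i
    e = slack D
    s≥0 : 0ℚ ≤ s
    s≥0 = ℚP.≤-trans (ℚP.nonNegative⁻¹ 1ℚ) (stretch≥1 i)
    regroup : ∀ s e l₁ l₂ l₃ → s * l₁ + (e + ((e + (l₂ + e)) + (e + s * l₃))) ≡ s * l₁ + (l₂ + s * l₃) + ℕtoℚ 4 * e
    regroup = solve-∀ ℚ-ring
    factor : ∀ s l₁ l₂ l₃ → s * l₁ + (s * l₂ + s * l₃) ≡ s * (l₁ + (l₂ + l₃))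
    factor = solve-∀ ℚ-ring

  pivot-route≤ : ∀ {l₁ l₂ l₃ D} → 0ℚ ≤ l₃ → l₁ + (l₂ + l₃) ≤ D →
                 l₁ + (slack D + (slack D + (l₂ + slack D))) ≤ pivotStretch * D
  pivot-route≤ {l₁} {l₂} {l₃} {D} l₃≥0 l≤D = begin
    l₁ + (e + (e + (l₂ + e)))   ≡⟨ regroup e l₁ l₂ ⟩
    l₁ + l₂ + ℕtoℚ 3 * e        ≤⟨ ℚP.+-monoˡ-≤ (ℕtoℚ 3 * e) (ℚP.≤-trans (p≤p+q (l₁ + l₂) l₃≥0)
                                                                 (ℚP.≤-reflexive (ℚP.+-assoc l₁ l₂ l₃))) ⟩
    l₁ + (l₂ + l₃) + ℕtoℚ 3 * e ≤⟨ ℚP.+-monoˡ-≤ (ℕtoℚ 3 * e) l≤D ⟩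
    D + ℕtoℚ 3 * e              ≡⟨ pivotStretch-* D ⟨
    pivotStretch * D            ∎
    where
    open ≤-Reasoning
    e : ℚ
    e = slack D
    regroup : ∀ e l₁ l₂ → l₁ + (e + (e + (l₂ + e))) ≡ l₁ + l₂ + ℕtoℚ 3 * e
    regroup = solve-∀ ℚ-ring

module Spanner {n k : ℕ} {w : Weights n} (w-ok : IsUndirectedNonneg w)
               {dG : Fin n → Fin n → ℚ∞} (isG : IsShortestDist (GEdge w) dG)
               {A : ℕ → Fin n → Bool} (hier : IsHierarchy k A)
               {dH : Fin n → Fin n → ℚ∞} (isH : IsShortestDist (Construction.HEdge k A dG) dH) where

  open Construction k A dG

  module G = ShortestPaths isG
  module H = ShortestPaths isH

  GEdge-sym : ∀ {u v c} → GEdge w u v c → GEdge w v u c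
  GEdge-sym {u} {v} uv = trans (proj₁ w-ok v u) uv

  GEdge-nonneg : ∀ {u v c} → GEdge w u v c → 0ℚ ≤ c
  GEdge-nonneg {u} {v} {c} = proj₂ w-ok u v c

  dG-sym : ∀ {x y b} → dG x y ≤∞ fin b → dG y x ≤∞ fin b
  dG-sym = G.dist-sym GEdge-sym

  dG-nonneg : ∀ {x y b} → dG x y ≤∞ fin b → 0ℚ ≤ b
  dG-nonneg = G.dist-nonneg GEdge-nonneg

  HEdge-sym : ∀ {u v c} → HEdge u v c → HEdge v u c
  HEdge-sym (inj₁ v∈Bu , uv≡c) = inj₂ v∈Bu , G.dist-sym-fin GEdge-sym uv≡c
  HEdge-sym (inj₂ u∈Bv , uv≡c) = inj₁ u∈Bv , G.dist-sym-fin GEdge-sym uv≡c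

  dH-sym : ∀ {x y b} → dH x y ≤∞ fin b → dH y x ≤∞ fin b
  dH-sym = H.dist-sym HEdge-sym

  dG≤len-H : ∀ {x y} (p : Walk HEdge x y) → dG x y ≤∞ fin (len p)
  dG≤len-H nil                    = G.dist-refl
  dG≤len-H (cons c (_ , uv≡c) p) = G.dist-triangle (≤∞-reflexive uv≡c) (dG≤len-H p)

  dG≤dH : ∀ {x y b} → dH x y ≤∞ fin b → dG x y ≤∞ fin b
  dG≤dH xy≤b with H.dist-walk xy≤b
  ... | p , p≤b = ≤∞-≤-trans (dG≤len-H p) p≤b

  bunch-edge : ∀ {u v b} → InBunch u v → dG u v ≤∞ fin b → dH u v ≤∞ fin b
  bunch-edge v∈Bu uv≤b with ≤∞-fin⇒fin uv≤b
  ... | c , uv≡c , c≤b =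
    ≤∞-≤-trans (H.dist≤len (cons c (inj₁ v∈Bu , uv≡c) nil)) (subst (_≤ _) (sym (ℚP.+-identityʳ c)) c≤b)

  A-zero : ∀ u → A 0 u ≡ true
  A-zero = proj₁ hier

  ¬A-k : ∀ {u} → A k u ≡ true → ⊥
  ¬A-k {u} Aku with trans (sym Aku) (proj₁ (proj₂ hier) u)
  ... | ()

  A-antitone : ∀ {i j u} → i ℕ.≤ j → j ℕ.≤ k → A j u ≡ true → A i u ≡ true
  A-antitone i≤j = antitone (ℕP.≤⇒≤′ i≤j)
    where
    antitone : ∀ {i j u} → i ℕ.≤′ j → j ℕ.≤ k → A j u ≡ true → A i u ≡ true
    antitone ℕ.≤′-refl        _    Aju  = Aju
    antitone (ℕ.≤′-step i≤′j) j<k Asju = antitone i≤′j (ℕP.<⇒≤ j<k) (proj₂ (proj₂ hier) _ _ j<k Asju)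

  A⇒<k : ∀ {j u} → j ℕ.≤ k → A j u ≡ true → j < k
  A⇒<k j≤k Aju with ℕP.m≤n⇒m<n∨m≡n j≤k
  ... | inj₁ j<k  = j<k
  ... | inj₂ refl = ⊥-elim (¬A-k Aju)

  IsLevel : Fin n → ℕ → Set
  IsLevel u ℓ = ℓ < k × A ℓ u ≡ true × A (suc ℓ) u ≡ false

  level : ∀ u → ∃ (IsLevel u)
  level u with below k ℕP.≤-refl
    where
    below : ∀ m → m ℕ.≤ k → A m u ≡ true ⊎ ∃[ ℓ ] (ℓ < m × IsLevel u ℓ)
    below zero    _     = inj₁ (A-zero u)
    below (suc m) m<k with below m (ℕP.<⇒≤ m<k)
    ... | inj₂ (ℓ , ℓ<m , L) = inj₂ (ℓ , ℕP.m<n⇒m<1+n ℓ<m , L)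
    ... | inj₁ Amu with A (suc m) u in Asmu
    ...   | true  = inj₁ refl
    ...   | false = inj₂ (m , ℕP.n<1+n m , m<k , Amu , Asmu)
  ... | inj₁ Aku           = ⊥-elim (¬A-k Aku)
  ... | inj₂ (ℓ , _ , L) = ℓ , L

  level-max : ∀ {u ℓ j} → IsLevel u ℓ → j ℕ.≤ k → A j u ≡ true → j ℕ.≤ ℓ
  level-max {u} {ℓ} {j} (_ , _ , Asℓu) j≤k Aju with j ℕP.≤? ℓ
  ... | yes j≤ℓ = j≤ℓ
  ... | no  j≰ℓ with trans (sym (A-antitone (ℕP.≰⇒> j≰ℓ) j≤k Aju)) Asℓu
  ...   | ()

  in-bunch : ∀ {u v i} → IsLevel u i →
             (A i v ≡ true × dG u v <∞ distToSet u (suc i)) ⊎ (∃[ j ] (i < j × j < k × IsPivot j u v)) →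
             InBunch u v
  in-bunch (i<k , Aiu , Asiu) reason = _ , i<k , Aiu , Asiu , reason

  private
    members : Fin n → ℕ → List ℚ∞
    members u j = map (dG u) (filter (λ a → A j a ≟ true) (allFin n))

  distToSet≤ : ∀ {u j a} → A j a ≡ true → distToSet u j ≤∞ dG u a
  distToSet≤ {u} {j} {a} Aja =
    foldr-min∞-≤ (members u j) (∈-map⁺ (dG u) (∈-filter⁺ (λ b → A j b ≟ true) (∈-allFin a) Aja))

  distToSet-attained : ∀ u j → distToSet u j ≡ ∞ ⊎ ∃[ a ] (A j a ≡ true × distToSet u j ≡ dG u a)
  distToSet-attained u j with foldr-min∞-attained (members u j)
  ... | inj₁ d≡∞ = inj₁ d≡∞
  ... | inj₂ d∈  with ∈-map⁻ (dG u) d∈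
  ...   | a , a∈ , d≡ua = inj₂ (a , proj₂ (∈-filter⁻ (λ b → A j b ≟ true) {xs = allFin n} a∈) , d≡ua)

  distToSet-witness : ∀ {u j b} → distToSet u j ≤∞ fin b → ∃[ a ] (A j a ≡ true × dG u a ≤∞ fin b)
  distToSet-witness {u} {j} d≤b with distToSet-attained u j
  ... | inj₁ d≡∞              = ⊥-elim (subst (_≤∞ fin _) d≡∞ d≤b)
  ... | inj₂ (a , Aja , d≡ua) = a , Aja , subst (_≤∞ fin _) d≡ua d≤b

  pivot-exists : ∀ {j u a} → A j a ≡ true → ∃ (IsPivot j u)
  pivot-exists {j} {u} {a} Aja with least Closest closest? closest-exists
    where
    Closest : Fin n → Set
    Closest p = A j p ≡ true × (∀ b → A j b ≡ true → dG u p ≤∞ dG u b)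

    closest? : ∀ p → Dec (Closest p)
    closest? p = (A j p ≟ true) ×-dec FinP.all? (λ b → (A j b ≟ true) →-dec (dG u p ≤∞? dG u b))

    closest-exists : ∃ Closest
    closest-exists with distToSet-attained u j
    ... | inj₁ d≡∞ = a , Aja , λ b Ajb → ≤∞-trans (≤∞-∞ (dG u a)) (subst (_≤∞ dG u b) d≡∞ (distToSet≤ Ajb))
    ... | inj₂ (m , Ajm , d≡um) = m , Ajm , λ b Ajb → subst (_≤∞ dG u b) d≡um (distToSet≤ Ajb)
  ... | p , (Ajp , p-closest) , p-least =
    p , Ajp , p-closest , λ b Ajb tie → p-least b (Ajb , λ c Ajc → subst (_≤∞ dG u c) (sym tie) (p-closest c Ajc))

  pivot-closest : ∀ {j u p a} → IsPivot j u p → A j a ≡ true → dG u p ≤∞ dG u a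
  pivot-closest (_ , p-closest , _) = p-closest _

  bunch-dichotomy : ∀ {m a b β} → m < k → A m a ≡ true → A m b ≡ true → dG a b ≤∞ fin β →
                    dH a b ≤∞ fin β ⊎ ∃[ a′ ] (A (suc m) a′ ≡ true × dG a a′ ≤∞ fin β)
  bunch-dichotomy {m} {a} {b} m<k Ama Amb ab≤β with A (suc m) a in Asma
  ... | true  = inj₂ (a , Asma , ≤∞-≤-trans G.dist-refl (dG-nonneg ab≤β))
  ... | false with dG a b <∞? distToSet a (suc m)
  ...   | yes b-inside = inj₁ (bunch-edge (in-bunch (m<k , Ama , Asma) (inj₁ (Amb , b-inside))) ab≤β)
  ...   | no  b-beyond = inj₂ (distToSet-witness (≤∞-trans (≮∞⇒≥∞ b-beyond) ab≤β))

  pivot-in-bunch : ∀ {u ℓ m a β} → IsLevel u ℓ → ℓ < m → m < k → A m a ≡ true → dG u a ≤∞ fin β →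
                   ∃[ p ] (IsPivot m u p × dH u p ≤∞ fin β)
  pivot-in-bunch {m = m} L ℓ<m m<k Ama ua≤β with pivot-exists Ama
  ... | p , p-pivot =
    p , p-pivot , bunch-edge (in-bunch L (inj₂ (m , ℓ<m , m<k , p-pivot))) (≤∞-trans (pivot-closest p-pivot Ama) ua≤β)

  -- From the endpoint of lower level either the other endpoint is in its bunch, or the next pivot is,
  -- at distance 0 and of strictly higher level; so (k ∸ ℓu) + (k ∸ ℓv) bounds the number of hops.
  dH-zero : ∀ N {u v ℓu ℓv} → IsLevel u ℓu → IsLevel v ℓv → (k ∸ ℓu) ℕ.+ (k ∸ ℓv) ℕ.≤ N →
            dG u v ≤∞ fin 0ℚ → dH u v ≤∞ fin 0ℚ
  dH-zero-from-lower : ∀ N {u v ℓu ℓv} → IsLevel u ℓu → IsLevel v ℓv → ℓu ℕ.≤ ℓv →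
                       (k ∸ ℓu) ℕ.+ (k ∸ ℓv) ℕ.≤ suc N → dG u v ≤∞ fin 0ℚ → dH u v ≤∞ fin 0ℚ

  dH-zero zero    {ℓu = ℓu} {ℓv} (ℓu<k , _) _ bound _ =
    ⊥-elim (ℕP.<⇒≱ (ℕP.m<n⇒0<n∸m ℓu<k) (ℕP.≤-trans (ℕP.m≤m+n (k ∸ ℓu) (k ∸ ℓv)) bound))
  dH-zero (suc N) {ℓu = ℓu} {ℓv} Lu Lv bound uv≤0 with ℓu ℕP.≤? ℓv
  ... | yes ℓu≤ℓv = dH-zero-from-lower N Lu Lv ℓu≤ℓv bound uv≤0
  ... | no  ℓu≰ℓv = dH-sym (dH-zero-from-lower N Lv Lu (ℕP.<⇒≤ (ℕP.≰⇒> ℓu≰ℓv))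
                              (subst (ℕ._≤ suc N) (ℕP.+-comm (k ∸ ℓu) (k ∸ ℓv)) bound) (dG-sym uv≤0))

  dH-zero-from-lower N {ℓu = ℓu} {ℓv} Lu@(ℓu<k , Aℓuu , _) Lv@(ℓv<k , Aℓvv , _) ℓu≤ℓv bound uv≤0
    with bunch-dichotomy ℓu<k Aℓuu (A-antitone ℓu≤ℓv (ℕP.<⇒≤ ℓv<k) Aℓvv) uv≤0
  ... | inj₁ v-in-bunch = v-in-bunch
  ... | inj₂ (a , Asa , ua≤0) with pivot-in-bunch Lu (ℕP.n<1+n ℓu) (A⇒<k ℓu<k Asa) Asa ua≤0
  ...   | p , (Asp , _) , up≤0 with level p
  ...     | ℓp , Lp@(ℓp<k , _) = H.dist-triangle up≤0 (dH-zero N Lp Lv bound′ pv≤0)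
    where
    pv≤0 : dG p _ ≤∞ fin 0ℚ
    pv≤0 = G.dist-triangle (dG-sym (dG≤dH up≤0)) uv≤0
    bound′ : (k ∸ ℓp) ℕ.+ (k ∸ ℓv) ℕ.≤ N
    bound′ = ℕP.≤-pred (ℕP.≤-trans (ℕP.+-monoˡ-< (k ∸ ℓv) (ℕP.∸-monoʳ-< (level-max Lp ℓu<k Asp) (ℕP.<⇒≤ ℓp<k))) bound)

  -- If u ∈ A m, its pivot is a vertex at G-distance 0 that need not be u itself (ties are broken by
  -- index) and need not lie in B(u); dH-zero handles this case.
  pivot-in-reach : ∀ {m u a β} → m ℕ.≤ k → A m a ≡ true → dG u a ≤∞ fin β →
                   ∃[ p ] (IsPivot m u p × dH u p ≤∞ fin β)
  pivot-in-reach {m} {u} m≤k Ama ua≤β with level u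
  ... | ℓ , L@(ℓ<k , Aℓu , _) with ℓ ℕP.<? m
  ...   | yes ℓ<m = pivot-in-bunch L ℓ<m (A⇒<k m≤k Ama) Ama ua≤β
  ...   | no  ℓ≮m with pivot-exists {u = u} Ama
  ...     | p , p-pivot with level p
  ...       | ℓp , Lp = p , p-pivot , ≤∞-≤-trans (dH-zero _ L Lp ℕP.≤-refl up≤0) (dG-nonneg ua≤β)
    where
    up≤0 : dG u p ≤∞ fin 0ℚ
    up≤0 = ≤∞-trans (pivot-closest p-pivot (A-antitone (ℕP.≮⇒≥ ℓ≮m) (ℕP.<⇒≤ ℓ<k) Aℓu)) G.dist-refl

  module Induction (Δ : ℚ) (Δ>3 : Δ > ℕtoℚ 3) where
    open Constants Δ Δ>3

    Outcome : ℕ → Fin n → Fin n → ℚ → Set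
    Outcome i x y L =
      dH x y ≤∞ fin (stretch i * L) ⊎ ∃[ a ] (A (suc i) a ≡ true × dG x a ≤∞ fin (pivotStretch * L))

    Claim : ℕ → Set
    Claim i = ∀ {W x y} → 0ℚ ≤ W → (P : Walk (GEdge w) x y) → EdgesAtMost W P → scale i * W ≤ len P →
              Outcome i x y (len P)

    claim-zero : 0 < k → Claim 0
    claim-zero 0<k _ P _ _ with bunch-dichotomy 0<k (A-zero _) (A-zero _) (G.dist≤len P)
    ... | inj₁ xy≤P             = inj₁ (≤∞-≤-trans xy≤P (p≤q*p (len-nonneg GEdge-nonneg P) (stretch≥1 0)))
    ... | inj₂ (a , A₁a , xa≤P) = inj₂ (a , A₁a , ≤∞-≤-trans xa≤P (≤pivotStretch* (len-nonneg GEdge-nonneg P)))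

    module Step {j} (sj<k : suc j < k) (IH : Claim j) {W} (W≥0 : 0ℚ ≤ W)
                {D} (3ΔT≤D : ℕtoℚ 3 * Δ * (scale j * W) ≤ D) where

      T : ℚ
      T = scale j * W

      T≥0 : 0ℚ ≤ T
      T≥0 = *-nonneg (ℚP.≤-trans (ℚP.nonNegative⁻¹ 1ℚ) (1≤scale j)) W≥0

      W≤T : W ≤ T
      W≤T = p≤q*p W≥0 (1≤scale j)

      T≤D : T ≤ D
      T≤D = ℚP.≤-trans (p≤q*p T≥0 1≤3Δ) 3ΔT≤D

      2T≤3T : T + T ≤ T + T + T
      2T≤3T = p≤p+q (T + T) T≥0

      Near : Fin n → Set
      Near u = ∃[ a ] (A (suc j) a ≡ true × dH u a ≤∞ fin (slack D))

      Stretched : Fin n → Fin n → ℚ → Set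
      Stretched u v l = dG u v ≤∞ fin l × dH u v ≤∞ fin (stretch j * l)

      stretched-refl : ∀ {u} → Stretched u u 0ℚ
      stretched-refl = G.dist-refl , ≤∞-≤-trans H.dist-refl (ℚP.≤-reflexive (sym (ℚP.*-zeroʳ (stretch j))))

      stretched-++ : ∀ {u v z a b} → Stretched u v a → Stretched v z b → Stretched u z (a + b)
      stretched-++ {a = a} {b} (uv≤a , uv≤sa) (vz≤b , vz≤sb) =
        G.dist-triangle uv≤a vz≤b ,
        ≤∞-≤-trans (H.dist-triangle uv≤sa vz≤sb) (ℚP.≤-reflexive (sym (ℚP.*-distribˡ-+ (stretch j) a b)))

      record Detour (x y : Fin n) (Λ : ℚ) : Set where
        field
          u v      : Fin n
          l₁ l₂ l₃ : ℚ
          lengths  : l₁ + (l₂ + l₃) ≤ Λ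
          head     : Stretched x u l₁
          middle   : dG u v ≤∞ fin l₂
          tail     : Stretched v y l₃
          near-u   : Near u
          near-v   : Near v

      Covered : Fin n → Fin n → ℚ → Set
      Covered x y Λ = Stretched x y Λ ⊎ Detour x y Λ

      detour : ∀ {u v L} → dG u v ≤∞ fin L → Near u → Near v → Detour u v L
      detour {L = L} uv≤L near-u near-v = record
        { l₁ = 0ℚ ; l₂ = L ; l₃ = 0ℚ ; lengths = ℚP.≤-reflexive (trans (ℚP.+-identityˡ _) (ℚP.+-identityʳ L))
        ; head = stretched-refl ; middle = uv≤L ; tail = stretched-refl ; near-u = near-u ; near-v = near-v }

      covered-++ : ∀ {x z y a b} → Covered x z a → Covered z y b → Covered x y (a + b)
      covered-++ (inj₁ g) (inj₁ h) = inj₁ (stretched-++ g h)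
      covered-++ {a = a} (inj₁ g) (inj₂ F) = inj₂ (record
        { l₁ = a + l₁ ; l₂ = l₂ ; l₃ = l₃
        ; lengths = ℚP.≤-trans (ℚP.≤-reflexive (ℚP.+-assoc a l₁ (l₂ + l₃))) (ℚP.+-monoʳ-≤ a lengths)
        ; head = stretched-++ g head ; middle = middle ; tail = tail ; near-u = near-u ; near-v = near-v })
        where open Detour F
      covered-++ {b = b} (inj₂ F) (inj₁ h) = inj₂ (record
        { l₁ = l₁ ; l₂ = l₂ ; l₃ = l₃ + b
        ; lengths = ℚP.≤-trans (ℚP.≤-reflexive (regroup l₁ l₂ l₃ b)) (ℚP.+-monoˡ-≤ b lengths)
        ; head = head ; middle = middle ; tail = stretched-++ tail h ; near-u = near-u ; near-v = near-v })
        where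
        open Detour F
        regroup : ∀ p q r s → p + (q + (r + s)) ≡ p + (q + r) + s
        regroup = solve-∀ ℚ-ring
      covered-++ (inj₂ F) (inj₂ F′) = inj₂ (record
        { l₁ = F.l₁ ; l₂ = F.l₂ + F.l₃ + F′.l₁ + F′.l₂ ; l₃ = F′.l₃
        ; lengths = ℚP.≤-trans (ℚP.≤-reflexive (regroup F.l₁ F.l₂ F.l₃ F′.l₁ F′.l₂ F′.l₃))
                               (ℚP.+-mono-≤ F.lengths F′.lengths)
        ; head = F.head ; tail = F′.tail ; near-u = F.near-u ; near-v = F′.near-v
        ; middle = G.dist-triangle (G.dist-triangle (G.dist-triangle F.middle (proj₁ F.tail)) (proj₁ F′.head))
                                   F′.middle })
        where
        module F = Detour F
        module F′ = Detour F′
        regroup : ∀ p q r p′ q′ r′ → p + ((q + r + p′ + q′) + r′) ≡ p + (q + r) + (p′ + (q′ + r′))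
        regroup = solve-∀ ℚ-ring

      segment : ∀ {u v} (S : Walk (GEdge w) u v) → EdgesAtMost W S → T ≤ len S → len S ≤ T + T + T →
                Covered u v (len S)
      segment {u} {v} S S≤W T≤S S≤3T = classify (IH W≥0 S S≤W T≤S) backwards
        where
        len-S⁻¹ : len (reverse GEdge-sym S) ≡ len S
        len-S⁻¹ = len-reverse GEdge-sym S

        backwards : Outcome j v u (len S)
        backwards = subst (Outcome j v u) len-S⁻¹ (IH W≥0 (reverse GEdge-sym S)
                      (EdgesAtMost-reverse GEdge-sym S S≤W) (subst (T ≤_) (sym len-S⁻¹) T≤S))

        near : ∀ {z} → ∃[ a ] (A (suc j) a ≡ true × dG z a ≤∞ fin (pivotStretch * len S)) → Near z
        near {z} (a , Asja , za≤) =
          forget-pivot (pivot-in-reach (ℕP.<⇒≤ sj<k) Asja (≤∞-≤-trans za≤ (pivotStretch*≤slack 3ΔT≤D S≤3T)))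
          where
          forget-pivot : ∃[ p ] (IsPivot (suc j) z p × dH z p ≤∞ fin (slack D)) → Near z
          forget-pivot (p , (Asjp , _) , zp≤) = p , Asjp , zp≤

        classify : Outcome j u v (len S) → Outcome j v u (len S) → Covered u v (len S)
        classify (inj₁ uv≤)   _             = inj₁ (G.dist≤len S , uv≤)
        classify (inj₂ _)     (inj₁ vu≤)    = inj₁ (G.dist≤len S , dH-sym vu≤)
        classify (inj₂ far-u) (inj₂ far-v)  = inj₂ (detour (G.dist≤len S) (near far-u) (near far-v))

      -- Q is the open piece and R the rest of the walk.  A piece is closed once it is longer than T, hence
      -- at most 2T since edges weigh at most T; a rest shorter than T is merged into the last piece.
      cover : ∀ {u z y} (Q : Walk (GEdge w) u z) (R : Walk (GEdge w) z y) → len Q ≤ T → T ≤ len Q + len R →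
              EdgesAtMost W Q → EdgesAtMost W R → Covered u y (len Q + len R)
      cover-past : ∀ {u z y} (Q : Walk (GEdge w) u z) (R : Walk (GEdge w) z y) → len Q ≤ T + T →
                   T ≤ len Q + len R → EdgesAtMost W Q → EdgesAtMost W R → Covered u y (len Q + len R)

      cover Q nil Q≤T T≤Q Q≤W _ =
        subst (Covered _ _) (sym (ℚP.+-identityʳ (len Q)))
          (segment Q Q≤W (subst (T ≤_) (ℚP.+-identityʳ (len Q)) T≤Q)
                   (ℚP.≤-trans Q≤T (ℚP.≤-trans (p≤p+q T T≥0) 2T≤3T)))
      cover Q (cons c e R) Q≤T T≤QR Q≤W (c≤W , R≤W) =
        subst (Covered _ _) snoc-len
          (cover-past Q′ R Q′≤2T (subst (T ≤_) (sym snoc-len) T≤QR) (EdgesAtMost-++ Q Q≤W (c≤W , tt)) R≤W)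
        where
        Q′ : Walk (GEdge w) _ _
        Q′ = Q ++ cons c e nil
        snoc-len : len Q′ + len R ≡ len Q + (c + len R)
        snoc-len = trans (cong (_+ len R) (len-++ Q (cons c e nil))) (regroup (len Q) c (len R))
          where
          regroup : ∀ q c r → q + (c + 0ℚ) + r ≡ q + (c + r)
          regroup = solve-∀ ℚ-ring
        Q′≤2T : len Q′ ≤ T + T
        Q′≤2T = subst (_≤ T + T) (sym (len-++ Q (cons c e nil)))
                  (ℚP.+-mono-≤ Q≤T (subst (_≤ T) (sym (ℚP.+-identityʳ c)) (ℚP.≤-trans c≤W W≤T)))

      cover-past Q R Q≤2T T≤QR Q≤W R≤W with len Q ℚP.≤? T
      ... | yes Q≤T = cover Q R Q≤T T≤QR Q≤W R≤W
      ... | no  Q≰T with len R ℚP.<? T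
      ...   | yes R<T = subst (Covered _ _) (len-++ Q R)
                          (segment (Q ++ R) (EdgesAtMost-++ Q Q≤W R≤W) (subst (T ≤_) (sym (len-++ Q R)) T≤QR)
                            (subst (_≤ T + T + T) (sym (len-++ Q R)) (ℚP.+-mono-≤ Q≤2T (ℚP.<⇒≤ R<T))))
      ...   | no  R≮T = covered-++ (segment Q Q≤W (ℚP.<⇒≤ (ℚP.≰⇒> Q≰T)) (ℚP.≤-trans Q≤2T 2T≤3T))
                          (subst (Covered _ _) (ℚP.+-identityˡ (len R))
                            (cover nil R T≥0 (subst (T ≤_) (sym (ℚP.+-identityˡ (len R))) (ℚP.≮⇒≥ R≮T)) tt R≤W))

      cover-walk : ∀ {x y} (P : Walk (GEdge w) x y) → EdgesAtMost W P → T ≤ len P → Covered x y (len P)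
      cover-walk P P≤W T≤P =
        subst (Covered _ _) (ℚP.+-identityˡ (len P))
          (cover nil P T≥0 (subst (T ≤_) (sym (ℚP.+-identityˡ (len P))) T≤P) tt P≤W)

      conclude-detour : ∀ {x y} → Detour x y D → Outcome (suc j) x y D
      conclude-detour {x} {y} F = via near-u near-v
        where
        open Detour F
        via : Near u → Near v → Outcome (suc j) x y D
        via (a , Asja , ua≤e) (b , Asjb , vb≤e) = finish (bunch-dichotomy sj<k Asja Asjb ab≤)
          where
          ab≤ : dG a b ≤∞ fin (slack D + (l₂ + slack D))
          ab≤ = G.dist-triangle (dG-sym (dG≤dH ua≤e)) (G.dist-triangle middle (dG≤dH vb≤e))
          finish : dH a b ≤∞ fin (slack D + (l₂ + slack D))
                   ⊎ ∃[ a′ ] (A (suc (suc j)) a′ ≡ true × dG a a′ ≤∞ fin (slack D + (l₂ + slack D))) →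
                   Outcome (suc j) x y D
          finish (inj₁ ab≤H) = inj₁ (≤∞-≤-trans
            (H.dist-triangle (proj₂ head) (H.dist-triangle ua≤e
              (H.dist-triangle ab≤H (H.dist-triangle (dH-sym vb≤e) (proj₂ tail)))))
            (bunch-route≤ {j} {l₁} {l₂} (dG-nonneg middle) lengths))
          finish (inj₂ (a′ , Assja′ , aa′≤)) = inj₂ (a′ , Assja′ , ≤∞-≤-trans
            (G.dist-triangle (proj₁ head) (G.dist-triangle (dG≤dH ua≤e) aa′≤))
            (pivot-route≤ {l₁} {l₂} (dG-nonneg (proj₁ tail)) lengths))

      conclude : ∀ {x y} → Covered x y D → Outcome (suc j) x y D
      conclude (inj₁ (_ , xy≤)) = inj₁ (≤∞-≤-trans xy≤ (stretch-mono j (ℚP.≤-trans T≥0 T≤D)))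
      conclude (inj₂ F)         = conclude-detour F

    claim-suc : ∀ {j} → suc j < k → Claim j → Claim (suc j)
    claim-suc {j} sj<k IH {W} W≥0 P P≤W hyp = conclude (cover-walk P P≤W T≤D)
      where open Step sj<k IH W≥0 (subst (_≤ len P) (ℚP.*-assoc (ℕtoℚ 3 * Δ) (scale j) W) hyp)

    claim : ∀ i → i < k → Claim i
    claim zero    0<k  = claim-zero 0<k
    claim (suc i) si<k = claim-suc si<k (claim i (ℕP.<⇒≤ si<k))

lemma3p1 : (n k : ℕ) → k ≥ 1 →
    (w : Weights n) → IsUndirectedNonneg w →
    (dG : Fin n → Fin n → ℚ∞) → IsShortestDist (GEdge w) dG →
    (A : ℕ → Fin n → Bool) → IsHierarchy k A →
    (dH : Fin n → Fin n → ℚ∞) → IsShortestDist (Construction.HEdge k A dG) dH →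
    (Δ : ℚ) → (Δ>3 : Δ > ℕtoℚ 3) →
    (i : ℕ) → i < k →
    (x y : Fin n) →
    (D : ℚ) → dG x y ≡ fin D →
    (P : Walk (GEdge w) x y) → len P ≡ D →
    ((ℕtoℚ 3 * Δ) ^ℚ i) * maxW P ≤ D →
    (dH x y ≤∞ fin ((1ℚ + divPos (ℕtoℚ (4 *ℕ i)) (Δ - ℕtoℚ 3) (Δ-3>0 Δ Δ>3)) * D))
    ⊎
    (∃[ p ] (Construction.IsPivot k A dG (suc i) x p ×
             dH x p ≤∞ fin (divPos Δ (Δ - ℕtoℚ 3) (Δ-3>0 Δ Δ>3) * D)))
lemma3p1 n k _ w w-ok dG isG A hier dH isH Δ Δ>3 i i<k x y D _ P refl P-long =
  map₂ (λ (a , A-a , xa≤) → pivot-in-reach i<k A-a xa≤)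
       (claim i i<k (maxW-nonneg P) P (EdgesAtMost-maxW P) P-long)
  where
  open Spanner w-ok isG hier isH
  open Induction Δ Δ>3
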